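{- Let $G$ be a finite simple graph and $v$ a vertex of $G$ with $r_2(G-v) = r_2(G)$. Let $S\subseteq V(G)\setminus\{v\}$ be a set of vertices such that the symmetric difference of the open neighborhoods $N(s)$, $s\in S$, equals $N(v)$. If there is a minimum odd cover $\mathscr{B}$ of $G-v$ containing no biclique $(X,Y)$ with both $|X\cap S|$ and $|Y\cap S|$ odd, then $b_2(G)=b_2(G-v)$.
   Context: For a finite simple graph $G=(V,E)$, a biclique on a subset of $V$ is given by two disjoint sets $X,Y\subseteq V$ (written $(X,Y)$); its edges are all pairs $\{x,y\}$ with $x\in X$, $y\in Y$. An odd cover of $G$ is a collection of bicliques on subsets of $V$ such that every pair of vertices adjacent in $G$ is an edge of an odd number of the bicliques, and every pair of distinct non-adjacent vertices is an edge of an even number of the bicliques. $b_2(G)$ denotes the minimum cardinality of an odd cover of $G$, and a minimum odd cover is one of this cardinality. $r_2(G)$ denotes the rank over $\mathbb{F}_2$ of the adjacency matrix of $G$. $G-v$ is the graph obtained by deleting $v$; $N(u)$ is the open neighborhood of $u$ in $G$. -}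

module Defs where

open import Data.Nat using (ℕ; zero; suc; _≤_)
open import Data.Bool using (Bool; true; false; _∧_; _∨_; _xor_; if_then_else_)
open import Data.Fin using (Fin; zero; suc; punchIn)
open import Data.List using (List; []; _∷_; length; map)
open import Data.Product using (Σ; _×_; ∃; ∃-syntax)
open import Relation.Binary.PropositionalEquality using (_≡_; _≢_)

VSet : ℕ → Set
VSet n = Fin n → Bool

card : ∀ {n} → VSet n → ℕ
card {zero} A = zero
card {suc n} A = (if A zero then suc else (λ k → k)) (card {n} (λ i → A (suc i)))

oddCard : ∀ {n} → VSet n → Bool
oddCard {zero} A = false
oddCard {suc n} A = A zero xor oddCard {n} (λ i → A (suc i))

oddCount : List Bool → Bool
oddCount [] = false
oddCount (b ∷ bs) = b xor oddCount bs

_∩_ : ∀ {n} → VSet n → VSet n → VSet n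
(A ∩ B) i = A i ∧ B i

_⊆_ : ∀ {n} → VSet n → VSet n → Set
A ⊆ B = ∀ i → A i ≡ true → B i ≡ true

record Graph (n : ℕ) : Set where
  field
    adj    : Fin n → Fin n → Bool
    sym    : ∀ u w → adj u w ≡ adj w u
    irrefl : ∀ u → adj u u ≡ false
open Graph public

-- G - v : delete vertex v; the vertices of G - v are Fin n, with
-- vertex i of G - v corresponding to vertex (punchIn v i) of G.
_─_ : ∀ {n} → Graph (suc n) → Fin (suc n) → Graph n
adj (G ─ v) i j = adj G (punchIn v i) (punchIn v j)
sym (G ─ v) i j = sym G (punchIn v i) (punchIn v j)
irrefl (G ─ v) i = irrefl G (punchIn v i)

N : ∀ {n} → Graph n → Fin n → VSet n
N G u w = adj G u w

record Biclique (n : ℕ) : Set where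
  constructor biclique
  field
    X : VSet n
    Y : VSet n
    disjoint : ∀ i → X i ∧ Y i ≡ false
open Biclique public

isEdge : ∀ {n} → Biclique n → Fin n → Fin n → Bool
isEdge B u w = (X B u ∧ Y B w) ∨ (X B w ∧ Y B u)

OddCover : ∀ {n} → Graph n → List (Biclique n) → Set
OddCover G Bs = ∀ u w → u ≢ w → oddCount (map (λ B → isEdge B u w) Bs) ≡ adj G u w

MinOddCover : ∀ {n} → Graph n → List (Biclique n) → Set
MinOddCover G Bs = OddCover G Bs × (∀ Cs → OddCover G Cs → length Bs ≤ length Cs)

B₂ : ∀ {n} → Graph n → ℕ → Set
B₂ G k = (Σ (List (Biclique _)) λ Bs → OddCover G Bs × length Bs ≡ k)
       × (∀ Cs → OddCover G Cs → k ≤ length Cs)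

-- Rank over F₂ of the adjacency matrix (row rank: maximum size of a
-- linearly independent set of rows; over F₂ a linear combination of rows
-- is the sum of the rows indexed by a subset J).
rowSum : ∀ {n} → Graph n → VSet n → VSet n
rowSum G J k = oddCard (λ i → J i ∧ adj G i k)

IndepRows : ∀ {n} → Graph n → VSet n → Set
IndepRows G I = ∀ J → J ⊆ I → (∃[ i ] J i ≡ true) → ∃[ k ] rowSum G J k ≡ true

R₂ : ∀ {n} → Graph n → ℕ → Set
R₂ G r = (Σ (VSet _) λ I → IndepRows G I × card I ≡ r)
       × (∀ I → IndepRows G I → card I ≤ r)

-- Membership in the symmetric difference of the neighbourhoods N(s), s ∈ S
-- (S a subset of the vertices of G - v, i.e. of V(G) ∖ {v}):
-- u lies in an odd number of the N(punchIn v s).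
symDiffN : ∀ {n} → Graph (suc n) → Fin (suc n) → VSet n → VSet (suc n)
symDiffN G v S u = oddCard (λ s → S s ∧ adj G (punchIn v s) u)

module Submission where

-- Extend every biclique (X, Y) of ℬ to G by putting v into X if |X ∩ S| is odd
-- and into Y if |Y ∩ S| is odd; by hypothesis at most one of the two happens.
-- Pairs avoiding v keep their parity.  A pair {v, u} is an edge of the extended
-- biclique iff u is joined in (X, Y) to an odd number of vertices of S, so
-- summing over ℬ its parity is |N(u) ∩ S| mod 2 in G − v, which is [u ∈ N(v)]
-- because N(v) is the symmetric difference of the N(s), s ∈ S.  This gives an
-- odd cover of G of size b₂(G − v); conversely deleting v from the bicliques of
-- any odd cover of G gives an odd cover of G − v, so b₂(G) ≥ b₂(G − v).

open import Defs
open import Data.Nat using (suc; zero; _≤_)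
open import Data.Bool using (Bool; true; false; _∧_; _∨_; _xor_; not)
open import Data.Bool.Properties
  using (∧-zeroʳ; ∧-distribˡ-xor; ∧-distribʳ-xor; ∨-comm; xor-∧-commutativeRing)
open import Data.Fin using (Fin; zero; suc; punchIn; punchOut; _≟_)
open import Data.Fin.Properties using (punchIn-punchOut; punchIn-injective)
open import Data.Vec.Functional using (insertAt; removeAt)
open import Data.Vec.Functional.Properties using (insertAt-lookup; insertAt-punchIn)
open import Data.List using (List; []; _∷_; length; map)
open import Data.List.Properties using (length-map; map-cong; map-cong-local; map-∘)
open import Data.List.Membership.Propositional using (_∈_)
import Data.List.Relation.Unary.All as All
open import Data.Product using (_,_)
open import Data.Empty using (⊥-elim)
open import Relation.Nullary using (yes; no)
open import Relation.Binary.PropositionalEquality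
  using (_≡_; refl; trans; cong; cong₂; subst; module ≡-Reasoning)
  renaming (sym to ≡-sym)
open import Algebra.Bundles using (CommutativeRing)
open import Algebra.Properties.CommutativeSemigroup
  (CommutativeRing.+-commutativeSemigroup xor-∧-commutativeRing) using (interchange)

∧-rearrange : ∀ a x y → a ∧ (x ∧ y) ≡ (x ∧ a) ∧ y
∧-rearrange false false y = refl
∧-rearrange false true  y = refl
∧-rearrange true  false y = refl
∧-rearrange true  true  y = refl

∧-∧-not-self : ∀ a b → a ∧ (b ∧ not a) ≡ false
∧-∧-not-self false b = refl
∧-∧-not-self true  b = ∧-zeroʳ b

edge-∨≡xor : ∀ xj yj x y → xj ∧ yj ≡ false → (x ∧ yj) ∨ (xj ∧ y) ≡ (x ∧ yj) xor (y ∧ xj)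
edge-∨≡xor false false false false _ = refl
edge-∨≡xor false false false true  _ = refl
edge-∨≡xor false false true  false _ = refl
edge-∨≡xor false false true  true  _ = refl
edge-∨≡xor false true  false false _ = refl
edge-∨≡xor false true  false true  _ = refl
edge-∨≡xor false true  true  false _ = refl
edge-∨≡xor false true  true  true  _ = refl
edge-∨≡xor true  false false false _ = refl
edge-∨≡xor true  false false true  _ = refl
edge-∨≡xor true  false true  false _ = refl
edge-∨≡xor true  false true  true  _ = refl
edge-∨≡xor true  true  _     _     ()

sideChoice-∨≡xor : ∀ a b x y → a ∧ b ≡ false → (a ∧ y) ∨ (x ∧ (b ∧ not a)) ≡ (a ∧ y) xor (b ∧ x)
sideChoice-∨≡xor false false false y     _ = refl
sideChoice-∨≡xor false false true  y     _ = refl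
sideChoice-∨≡xor false true  false y     _ = refl
sideChoice-∨≡xor false true  true  y     _ = refl
sideChoice-∨≡xor true  false false false _ = refl
sideChoice-∨≡xor true  false false true  _ = refl
sideChoice-∨≡xor true  false true  false _ = refl
sideChoice-∨≡xor true  false true  true  _ = refl
sideChoice-∨≡xor true  true  _     _     ()

oddCard-cong : ∀ {n} {f g : VSet n} → (∀ i → f i ≡ g i) → oddCard f ≡ oddCard g
oddCard-cong {zero}  f≗g = refl
oddCard-cong {suc n} f≗g = cong₂ _xor_ (f≗g zero) (oddCard-cong (λ i → f≗g (suc i)))

oddCard-∅ : ∀ {n} → oddCard {n} (λ _ → false) ≡ false
oddCard-∅ {zero}  = refl
oddCard-∅ {suc n} = oddCard-∅ {n}

oddCard-xor : ∀ {n} (f g : VSet n) → oddCard (λ s → f s xor g s) ≡ oddCard f xor oddCard g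
oddCard-xor {zero}  f g = refl
oddCard-xor {suc n} f g =
  trans (cong ((f zero xor g zero) xor_) (oddCard-xor (λ i → f (suc i)) (λ i → g (suc i))))
        (interchange (f zero) (g zero) _ _)

oddCard-∧ʳ : ∀ {n} (f : VSet n) b → oddCard (λ s → f s ∧ b) ≡ oddCard f ∧ b
oddCard-∧ʳ {zero}  f b = refl
oddCard-∧ʳ {suc n} f b =
  trans (cong ((f zero ∧ b) xor_) (oddCard-∧ʳ (λ i → f (suc i)) b))
        (≡-sym (∧-distribʳ-xor b (f zero) _))

oddCount-∧ˡ : ∀ {A : Set} a (f : A → Bool) xs → oddCount (map (λ x → a ∧ f x) xs) ≡ a ∧ oddCount (map f xs)
oddCount-∧ˡ a f []       = ≡-sym (∧-zeroʳ a)
oddCount-∧ˡ a f (x ∷ xs) = trans (cong ((a ∧ f x) xor_) (oddCount-∧ˡ a f xs)) (≡-sym (∧-distribˡ-xor a _ _))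

oddCount-oddCard : ∀ {A : Set} {n} (F : A → VSet n) xs →
                   oddCount (map (λ x → oddCard (F x)) xs) ≡ oddCard (λ s → oddCount (map (λ x → F x s) xs))
oddCount-oddCard {n = n} F [] = ≡-sym (oddCard-∅ {n})
oddCount-oddCard F (x ∷ xs) =
  trans (cong (oddCard (F x) xor_) (oddCount-oddCard F xs)) (≡-sym (oddCard-xor (F x) _))

edgeParity : ∀ {n} → List (Biclique n) → Fin n → Fin n → Bool
edgeParity Bs u w = oddCount (map (λ B → isEdge B u w) Bs)

isEdge-comm : ∀ {n} (B : Biclique n) u w → isEdge B u w ≡ isEdge B w u
isEdge-comm B u w = ∨-comm (X B u ∧ Y B w) (X B w ∧ Y B u)

edgeParity-comm : ∀ {n} (Bs : List (Biclique n)) u w → edgeParity Bs u w ≡ edgeParity Bs w u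
edgeParity-comm Bs u w = cong oddCount (map-cong (λ B → isEdge-comm B u w) Bs)

edgeParity-diag : ∀ {n} (Bs : List (Biclique n)) u → edgeParity Bs u u ≡ false
edgeParity-diag []       u = refl
edgeParity-diag (B ∷ Bs) u = cong₂ _xor_ (cong₂ _∨_ (disjoint B u) (disjoint B u)) (edgeParity-diag Bs u)

edgeParity-oddCover : ∀ {n} {G : Graph n} {Bs} → OddCover G Bs → ∀ u w → edgeParity Bs u w ≡ adj G u w
edgeParity-oddCover {G = G} {Bs} cover u w with u ≟ w
... | yes refl = trans (edgeParity-diag Bs u) (≡-sym (irrefl G u))
... | no u≢w   = cover u w u≢w

oddCard-∧-isEdge : ∀ {n} (S : VSet n) (B : Biclique n) j →
                   oddCard (λ s → S s ∧ isEdge B s j)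
                   ≡ (oddCard (X B ∩ S) ∧ Y B j) xor (oddCard (Y B ∩ S) ∧ X B j)
oddCard-∧-isEdge S B j = begin
  oddCard (λ s → S s ∧ isEdge B s j)
    ≡⟨ oddCard-cong (λ s → cong (S s ∧_) (edge-∨≡xor (X B j) (Y B j) (X B s) (Y B s) (disjoint B j))) ⟩
  oddCard (λ s → S s ∧ ((X B s ∧ Y B j) xor (Y B s ∧ X B j)))
    ≡⟨ oddCard-cong (λ s → trans (∧-distribˡ-xor (S s) _ _)
                                 (cong₂ _xor_ (∧-rearrange (S s) (X B s) (Y B j))
                                              (∧-rearrange (S s) (Y B s) (X B j)))) ⟩
  oddCard (λ s → ((X B ∩ S) s ∧ Y B j) xor ((Y B ∩ S) s ∧ X B j))
    ≡⟨ oddCard-xor (λ s → (X B ∩ S) s ∧ Y B j) (λ s → (Y B ∩ S) s ∧ X B j) ⟩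
  oddCard (λ s → (X B ∩ S) s ∧ Y B j) xor oddCard (λ s → (Y B ∩ S) s ∧ X B j)
    ≡⟨ cong₂ _xor_ (oddCard-∧ʳ (X B ∩ S) (Y B j)) (oddCard-∧ʳ (Y B ∩ S) (X B j)) ⟩
  (oddCard (X B ∩ S) ∧ Y B j) xor (oddCard (Y B ∩ S) ∧ X B j)
    ∎
  where open ≡-Reasoning

data VertexView {n} (v : Fin (suc n)) : Fin (suc n) → Set where
  at-v    : VertexView v v
  punched : ∀ i → VertexView v (punchIn v i)

vertexView : ∀ {n} (v u : Fin (suc n)) → VertexView v u
vertexView v u with v ≟ u
... | yes refl = at-v
... | no v≢u   = subst (VertexView v) (punchIn-punchOut v≢u) (punched (punchOut v≢u))

restrict : ∀ {n} → Fin (suc n) → Biclique (suc n) → Biclique n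
restrict v B = biclique (removeAt (X B) v) (removeAt (Y B) v) (λ i → disjoint B (punchIn v i))

restrict-oddCover : ∀ {n} (G : Graph (suc n)) v {Cs} → OddCover G Cs → OddCover (G ─ v) (map (restrict v) Cs)
restrict-oddCover G v {Cs} cover i j i≢j =
  trans (cong oddCount (≡-sym (map-∘ Cs))) (cover _ _ (λ e → i≢j (punchIn-injective v i j e)))

module VertexExtension {n} (v : Fin (suc n)) (S : VSet n) where

  NotBothOdd : Biclique n → Set
  NotBothOdd B = oddCard (X B ∩ S) ∧ oddCard (Y B ∩ S) ≡ false

  -- The `not` keeps the sides disjoint when both meet S oddly, a case the
  -- hypothesis of the theorem excludes.
  extendedX extendedY : Biclique n → VSet (suc n)
  extendedX B = insertAt (X B) v (oddCard (X B ∩ S))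
  extendedY B = insertAt (Y B) v (oddCard (Y B ∩ S) ∧ not (oddCard (X B ∩ S)))

  extended-disjoint : ∀ B u → extendedX B u ∧ extendedY B u ≡ false
  extended-disjoint B u with vertexView v u
  ... | at-v      = trans (cong₂ _∧_ (insertAt-lookup (X B) v _) (insertAt-lookup (Y B) v _))
                          (∧-∧-not-self (oddCard (X B ∩ S)) (oddCard (Y B ∩ S)))
  ... | punched i = trans (cong₂ _∧_ (insertAt-punchIn (X B) v _ i) (insertAt-punchIn (Y B) v _ i))
                          (disjoint B i)

  extend : Biclique n → Biclique (suc n)
  extend B = biclique (extendedX B) (extendedY B) (extended-disjoint B)

  isEdge-extend-punchIn : ∀ B i j → isEdge (extend B) (punchIn v i) (punchIn v j) ≡ isEdge B i j
  isEdge-extend-punchIn B i j =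
    cong₂ _∨_ (cong₂ _∧_ (insertAt-punchIn (X B) v _ i) (insertAt-punchIn (Y B) v _ j))
              (cong₂ _∧_ (insertAt-punchIn (X B) v _ j) (insertAt-punchIn (Y B) v _ i))

  isEdge-extend-v : ∀ {B} → NotBothOdd B → ∀ j →
                    isEdge (extend B) v (punchIn v j) ≡ oddCard (λ s → S s ∧ isEdge B s j)
  isEdge-extend-v {B} notBothOdd j = begin
    isEdge (extend B) v (punchIn v j)
      ≡⟨ cong₂ _∨_ (cong₂ _∧_ (insertAt-lookup (X B) v _) (insertAt-punchIn (Y B) v _ j))
                   (cong₂ _∧_ (insertAt-punchIn (X B) v _ j) (insertAt-lookup (Y B) v _)) ⟩
    (oddX ∧ Y B j) ∨ (X B j ∧ (oddY ∧ not oddX))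
      ≡⟨ sideChoice-∨≡xor oddX oddY (X B j) (Y B j) notBothOdd ⟩
    (oddX ∧ Y B j) xor (oddY ∧ X B j)
      ≡⟨ ≡-sym (oddCard-∧-isEdge S B j) ⟩
    oddCard (λ s → S s ∧ isEdge B s j)
      ∎
    where
    open ≡-Reasoning
    oddX oddY : Bool
    oddX = oddCard (X B ∩ S)
    oddY = oddCard (Y B ∩ S)

  edgeParity-extend-punchIn : ∀ Bs i j → edgeParity (map extend Bs) (punchIn v i) (punchIn v j) ≡ edgeParity Bs i j
  edgeParity-extend-punchIn Bs i j =
    cong oddCount (trans (≡-sym (map-∘ Bs)) (map-cong (λ B → isEdge-extend-punchIn B i j) Bs))

  edgeParity-extend-v : ∀ {Bs} → All.All NotBothOdd Bs → ∀ j →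
                        edgeParity (map extend Bs) v (punchIn v j) ≡ oddCard (λ s → S s ∧ edgeParity Bs s j)
  edgeParity-extend-v {Bs} notBothOdd j = begin
    edgeParity (map extend Bs) v (punchIn v j)
      ≡⟨ cong oddCount (≡-sym (map-∘ Bs)) ⟩
    oddCount (map (λ B → isEdge (extend B) v (punchIn v j)) Bs)
      ≡⟨ cong oddCount (map-cong-local (All.map (λ {B} h → isEdge-extend-v {B} h j) notBothOdd)) ⟩
    oddCount (map (λ B → oddCard (λ s → S s ∧ isEdge B s j)) Bs)
      ≡⟨ oddCount-oddCard (λ B s → S s ∧ isEdge B s j) Bs ⟩
    oddCard (λ s → oddCount (map (λ B → S s ∧ isEdge B s j) Bs))
      ≡⟨ oddCard-cong (λ s → oddCount-∧ˡ (S s) (λ B → isEdge B s j) Bs) ⟩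
    oddCard (λ s → S s ∧ edgeParity Bs s j)
      ∎
    where open ≡-Reasoning

  edgeParity-extend-v≡adj : ∀ (G : Graph (suc n)) {Bs} → All.All NotBothOdd Bs →
                            (∀ u → symDiffN G v S u ≡ N G v u) → OddCover (G ─ v) Bs →
                            ∀ j → edgeParity (map extend Bs) v (punchIn v j) ≡ adj G v (punchIn v j)
  edgeParity-extend-v≡adj G {Bs} notBothOdd N[v]≡ΔN[S] cover j = begin
    edgeParity (map extend Bs) v (punchIn v j)
      ≡⟨ edgeParity-extend-v notBothOdd j ⟩
    oddCard (λ s → S s ∧ edgeParity Bs s j)
      ≡⟨ oddCard-cong (λ s → cong (S s ∧_) (edgeParity-oddCover {G = G ─ v} {Bs} cover s j)) ⟩
    symDiffN G v S (punchIn v j)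
      ≡⟨ N[v]≡ΔN[S] (punchIn v j) ⟩
    adj G v (punchIn v j)
      ∎
    where open ≡-Reasoning

  extend-oddCover : ∀ (G : Graph (suc n)) {Bs} → All.All NotBothOdd Bs →
                    (∀ u → symDiffN G v S u ≡ N G v u) →
                    OddCover (G ─ v) Bs → OddCover G (map extend Bs)
  extend-oddCover G {Bs} notBothOdd N[v]≡ΔN[S] cover u w u≢w with vertexView v u | vertexView v w
  ... | at-v      | at-v      = ⊥-elim (u≢w refl)
  ... | at-v      | punched j = edgeParity-extend-v≡adj G notBothOdd N[v]≡ΔN[S] cover j
  ... | punched i | at-v      = begin
    edgeParity (map extend Bs) (punchIn v i) v ≡⟨ edgeParity-comm (map extend Bs) (punchIn v i) v ⟩
    edgeParity (map extend Bs) v (punchIn v i) ≡⟨ edgeParity-extend-v≡adj G notBothOdd N[v]≡ΔN[S] cover i ⟩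
    adj G v (punchIn v i)                       ≡⟨ Graph.sym G v (punchIn v i) ⟩
    adj G (punchIn v i) v                       ∎
    where open ≡-Reasoning
  ... | punched i | punched j =
    trans (edgeParity-extend-punchIn Bs i j) (cover i j (λ i≡j → u≢w (cong (punchIn v) i≡j)))

open VertexExtension using (extend; extend-oddCover)

lemma4p3 : ∀ {n} (G : Graph (suc n)) (v : Fin (suc n)) →
    (∀ r → R₂ G r → R₂ (G ─ v) r) →
    (S : VSet n) →
    (∀ u → symDiffN G v S u ≡ N G v u) →
    (ℬ : List (Biclique n)) → MinOddCover (G ─ v) ℬ →
    (∀ B → B ∈ ℬ → oddCard (X B ∩ S) ∧ oddCard (Y B ∩ S) ≡ false) →
    B₂ G (length ℬ)
lemma4p3 G v _ S N[v]≡ΔN[S] ℬ (cover , minimal) notBothOdd =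
  (map (extend v S) ℬ , extended-cover , length-map (extend v S) ℬ) , ℬ-minimal
  where
  extended-cover : OddCover G (map (extend v S) ℬ)
  extended-cover = extend-oddCover v S G (All.tabulate (λ {B} → notBothOdd B)) N[v]≡ΔN[S] cover

  ℬ-minimal : ∀ Cs → OddCover G Cs → length ℬ ≤ length Cs
  ℬ-minimal Cs Cs-cover =
    subst (length ℬ ≤_) (length-map (restrict v) Cs) (minimal (map (restrict v) Cs) (restrict-oddCover G v {Cs} Cs-cover))
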